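{- For every integer $l\ge 0$, setting $k=4l+2$, one has $\chi(\mathbb{Z}^{3},\sqrt{k})\le 4$.
   Context: For a metric space $M$ and a real number $d>0$, the chromatic number $\chi(M,d)$ is the minimal cardinality of a set $S$ for which there is a map $f:M\to S$ with $f(x)\neq f(y)$ whenever the distance between $x$ and $y$ equals $d$. Here $\mathbb{Z}^{3}$ carries the Euclidean metric. -}

module Defs where

open import Data.Nat using (ℕ)
open import Data.Integer using (ℤ; _+_; _-_; _*_)
open import Data.Fin using (Fin)
open import Data.Product using (Σ; _×_)
open import Relation.Binary.PropositionalEquality using (_≡_; _≢_)

ℤ³ : Set
ℤ³ = ℤ × ℤ × ℤ

dist² : ℤ³ → ℤ³ → ℤ
dist² (a₁ Data.Product., a₂ Data.Product., a₃) (b₁ Data.Product., b₂ Data.Product., b₃) =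
  (a₁ - b₁) * (a₁ - b₁) + (a₂ - b₂) * (a₂ - b₂) + (a₃ - b₃) * (a₃ - b₃)

-- A map f : ℤ³ → Fin n such that points at Euclidean distance √d
-- (i.e. squared distance d) receive different values.
-- χ(ℤ³, √d) ≤ n  iff  such a map exists (any set of cardinality ≤ n injects into Fin n).
χ≤ : ℤ → ℕ → Set
χ≤ d n = Σ (ℤ³ → Fin n) λ f → ∀ x y → dist² x y ≡ d → f x ≢ f y

module Submission where

-- Colour a point by its parity vector (x₁ mod 2, x₂ mod 2, x₃ mod 2) taken
-- modulo the all-ones vector, i.e. by the pair (x₁ ⊕ x₃ , x₂ ⊕ x₃) of bits.
-- If two points x, y get the same colour, the parities of their coordinate
-- differences x₁ - y₁, x₂ - y₂, x₃ - y₃ all agree.  Since a square is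
-- congruent mod 4 to the parity of its root, the squared distance of such
-- points is ≡ 0 (all differences even) or ≡ 3 (all odd) mod 4, never ≡ 2.
-- Hence points at squared distance 4l+2 always receive different colours.

open import Defs
open import Data.Nat using (ℕ; _+_; _*_; suc; s≤s)
open import Data.Integer as ℤ using (ℤ; +_; _-_; -_)
open import Data.Integer.Properties using (pos-*)
open import Data.Integer.DivMod using (_%_; _/_; n%d<d; a≡a%n+[a/n]*n)
open import Data.Integer.Divisibility.Signed
  using (_∣_; divides; _∣?_; ∣m∣n⇒∣m+n; ∣m⇒∣-m)
open import Data.Integer.Tactic.RingSolver using (solve)
open import Data.List using ([]; _∷_)
open import Data.Bool using (Bool; true; false; not; _xor_)
open import Data.Bool.Properties using (xor-identityʳ; xor-comm; xor-annihilates-not)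
open import Data.Fin using (Fin; zero; suc)
open import Data.Product using (_×_; _,_; ∃-syntax)
open import Relation.Nullary using (¬_)
open import Relation.Nullary.Decidable using (from-no)
open import Relation.Binary.PropositionalEquality
  using (_≡_; _≢_; refl; sym; trans; cong; cong₂; subst; subst₂; module ≡-Reasoning)

infix 4 _≡_mod_

-- a ≡ b (mod n): n divides a - b.  A record rather than an abbreviation, so
-- that a, b and n can be inferred from the type of a congruence.
record _≡_mod_ (a b n : ℤ) : Set where
  constructor congruent
  field divides-difference : n ∣ a - b

≡⇒≡-mod : ∀ {a b} n → a ≡ b → a ≡ b mod n
≡⇒≡-mod {a} n refl = congruent (divides (+ 0) a-a≡0*n)
  where
  a-a≡0*n : a - a ≡ + 0 ℤ.* n
  a-a≡0*n = solve (a ∷ n ∷ [])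

mod-sym : ∀ {a b n} → a ≡ b mod n → b ≡ a mod n
mod-sym {a} {b} {n} (congruent n∣a-b) =
  congruent (subst (n ∣_) -[a-b]≡b-a (∣m⇒∣-m n∣a-b))
  where
  -[a-b]≡b-a : - (a - b) ≡ b - a
  -[a-b]≡b-a = solve (a ∷ b ∷ [])

mod-trans : ∀ {a b c n} → a ≡ b mod n → b ≡ c mod n → a ≡ c mod n
mod-trans {a} {b} {c} {n} (congruent n∣a-b) (congruent n∣b-c) =
  congruent (subst (n ∣_) telescope (∣m∣n⇒∣m+n n∣a-b n∣b-c))
  where
  telescope : (a - b) ℤ.+ (b - c) ≡ a - c
  telescope = solve (a ∷ b ∷ c ∷ [])

mod-+ : ∀ {a b c d n} → a ≡ b mod n → c ≡ d mod n → a ℤ.+ c ≡ b ℤ.+ d mod n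
mod-+ {a} {b} {c} {d} {n} (congruent n∣a-b) (congruent n∣c-d) =
  congruent (subst (n ∣_) regroup (∣m∣n⇒∣m+n n∣a-b n∣c-d))
  where
  regroup : (a - b) ℤ.+ (c - d) ≡ (a ℤ.+ c) - (b ℤ.+ d)
  regroup = solve (a ∷ b ∷ c ∷ d ∷ [])

⟦_⟧ : Bool → ℤ
⟦ false ⟧ = + 0
⟦ true  ⟧ = + 1

isNonZero : ℕ → Bool
isNonZero 0       = false
isNonZero (suc _) = true

parity : ℤ → Bool
parity z = isNonZero (z % + 2)

parity-decomposition : ∀ z → z ≡ ⟦ parity z ⟧ ℤ.+ (z / + 2) ℤ.* + 2
parity-decomposition z with z % + 2 | n%d<d z (+ 2) | a≡a%n+[a/n]*n z (+ 2)
... | 0           | _            | z≡r+2q = z≡r+2q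
... | 1           | _            | z≡r+2q = z≡r+2q
... | suc (suc _) | s≤s (s≤s ()) | _

sq : ℤ → ℤ
sq z = z ℤ.* z

-- Shifting the two terms of a difference by even numbers does not change
-- its square mod 4: (A + 2u - (B + 2v))² = (A - B)² + 4 (u - v)(A - B + u - v).
square-even-shift : ∀ A B u v →
  sq ((A ℤ.+ u ℤ.* + 2) - (B ℤ.+ v ℤ.* + 2)) ≡ sq (A - B) mod + 4
square-even-shift A B u v =
  congruent (divides ((u - v) ℤ.* ((A - B) ℤ.+ (u - v))) expand)
  where
  expand : ((A ℤ.+ u ℤ.* + 2) - (B ℤ.+ v ℤ.* + 2)) ℤ.* ((A ℤ.+ u ℤ.* + 2) - (B ℤ.+ v ℤ.* + 2))
           - (A - B) ℤ.* (A - B)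
         ≡ ((u - v) ℤ.* ((A - B) ℤ.+ (u - v))) ℤ.* + 4
  expand = solve (A ∷ B ∷ u ∷ v ∷ [])

bit-difference-square : ∀ a b → sq (⟦ a ⟧ - ⟦ b ⟧) ≡ ⟦ a xor b ⟧
bit-difference-square false false = refl
bit-difference-square false true  = refl
bit-difference-square true  false = refl
bit-difference-square true  true  = refl

square-difference-mod4 : ∀ x y → sq (x - y) ≡ ⟦ parity x xor parity y ⟧ mod + 4
square-difference-mod4 x y =
  subst₂ (λ s t → s ≡ t mod + 4)
    (cong₂ (λ x′ y′ → sq (x′ - y′)) (sym (parity-decomposition x)) (sym (parity-decomposition y)))
    (bit-difference-square (parity x) (parity y))
    (square-even-shift ⟦ parity x ⟧ ⟦ parity y ⟧ (x / + 2) (y / + 2))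

Δparity : ℤ³ → ℤ³ → Bool × Bool × Bool
Δparity (x₁ , x₂ , x₃) (y₁ , y₂ , y₃) =
  parity x₁ xor parity y₁ , parity x₂ xor parity y₂ , parity x₃ xor parity y₃

bitSum : Bool × Bool × Bool → ℤ
bitSum (d₁ , d₂ , d₃) = ⟦ d₁ ⟧ ℤ.+ ⟦ d₂ ⟧ ℤ.+ ⟦ d₃ ⟧

dist²-mod4 : ∀ x y → dist² x y ≡ bitSum (Δparity x y) mod + 4
dist²-mod4 (x₁ , x₂ , x₃) (y₁ , y₂ , y₃) =
  mod-+ (mod-+ (square-difference-mod4 x₁ y₁) (square-difference-mod4 x₂ y₂))
        (square-difference-mod4 x₃ y₃)

pair : Bool → Bool → Fin 4
pair false false = zero
pair false true  = suc zero
pair true  false = suc (suc zero)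
pair true  true  = suc (suc (suc zero))

unpair : Fin 4 → Bool × Bool
unpair zero                = false , false
unpair (suc zero)          = false , true
unpair (suc (suc zero))    = true  , false
unpair (suc (suc (suc _))) = true  , true

unpair-pair : ∀ a b → unpair (pair a b) ≡ (a , b)
unpair-pair false false = refl
unpair-pair false true  = refl
unpair-pair true  false = refl
unpair-pair true  true  = refl

pair-injective : ∀ {a b c d} → pair a b ≡ pair c d → a ≡ c × b ≡ d
pair-injective {a} {b} {c} {d} eq
  with trans (sym (unpair-pair a b)) (trans (cong unpair eq) (unpair-pair c d))
... | refl = refl , refl

colour : ℤ³ → Fin 4
colour (x₁ , x₂ , x₃) = pair (parity x₁ xor parity x₃) (parity x₂ xor parity x₃)

xor-cancel-middle : ∀ a c b → (a xor c) xor (c xor b) ≡ a xor b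
xor-cancel-middle a false b = cong (_xor b) (xor-identityʳ a)
xor-cancel-middle a true  b = trans (cong (_xor not b) (xor-comm a true)) (xor-annihilates-not a b)

xor-transpose : ∀ a b c d → a xor c ≡ b xor d → a xor b ≡ c xor d
xor-transpose a b c d a⊕c≡b⊕d = begin
  a xor b                 ≡⟨ sym (xor-cancel-middle a c b) ⟩
  (a xor c) xor (c xor b) ≡⟨ cong (_xor (c xor b)) a⊕c≡b⊕d ⟩
  (b xor d) xor (c xor b) ≡⟨ xor-comm (b xor d) (c xor b) ⟩
  (c xor b) xor (b xor d) ≡⟨ xor-cancel-middle c b d ⟩
  c xor d                 ∎
  where open ≡-Reasoning

same-colour⇒equal-parities : ∀ x y → colour x ≡ colour y →
  ∃[ d ] Δparity x y ≡ (d , d , d)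
same-colour⇒equal-parities (x₁ , x₂ , x₃) (y₁ , y₂ , y₃) same
  with pair-injective same
... | e₁ , e₂ =
  parity x₃ xor parity y₃ ,
  cong₂ _,_ (xor-transpose (parity x₁) (parity y₁) (parity x₃) (parity y₃) e₁)
            (cong₂ _,_ (xor-transpose (parity x₂) (parity y₂) (parity x₃) (parity y₃) e₂) refl)

bitSum-thrice : ∀ d → bitSum (d , d , d) ≡ ⟦ d ⟧ ℤ.* + 3
bitSum-thrice false = refl
bitSum-thrice true  = refl

same-colour⇒dist²-mod4 : ∀ x y → colour x ≡ colour y →
  ∃[ d ] dist² x y ≡ ⟦ d ⟧ ℤ.* + 3 mod + 4
same-colour⇒dist²-mod4 x y same with same-colour⇒equal-parities x y same
... | d , Δ≡ddd =
  d , mod-trans (dist²-mod4 x y) (≡⇒≡-mod (+ 4) (trans (cong bitSum Δ≡ddd) (bitSum-thrice d)))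

4l+2≡2 : ∀ l → + (4 * l + 2) ≡ + 2 mod + 4
4l+2≡2 l = congruent (divides (+ l) (begin
  + (4 * l) ℤ.+ + 2 - + 2 ≡⟨ cong (λ t → t ℤ.+ + 2 - + 2) (pos-* 4 l) ⟩
  + 4 ℤ.* + l ℤ.+ + 2 - + 2 ≡⟨ cancel (+ l) ⟩
  + l ℤ.* + 4 ∎))
  where
  open ≡-Reasoning
  cancel : ∀ L → + 4 ℤ.* L ℤ.+ + 2 - + 2 ≡ L ℤ.* + 4
  cancel L = solve (L ∷ [])

2≢3d : ∀ d → ¬ (+ 2 ≡ ⟦ d ⟧ ℤ.* + 3 mod + 4)
2≢3d false (congruent 4∣2-0) = from-no (+ 4 ∣? (+ 2 - + 0)) 4∣2-0
2≢3d true  (congruent 4∣2-3) = from-no (+ 4 ∣? (+ 2 - + 3)) 4∣2-3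

3d≢2 : ∀ {k} d → k ≡ ⟦ d ⟧ ℤ.* + 3 mod + 4 → ¬ (k ≡ + 2 mod + 4)
3d≢2 d k≡3d k≡2 = 2≢3d d (mod-trans (mod-sym k≡2) k≡3d)

mainTheorem1 : (l : ℕ) → χ≤ (+ (4 * l + 2)) 4
mainTheorem1 l = colour , separates
  where
  separates : ∀ x y → dist² x y ≡ + (4 * l + 2) → colour x ≢ colour y
  separates x y dist²≡k same =
    let d , dist²≡3d = same-colour⇒dist²-mod4 x y same
    in 3d≢2 d dist²≡3d (subst (_≡ + 2 mod + 4) (sym dist²≡k) (4l+2≡2 l))
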